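{- Let $m>2$ be even. There is no subgraph $H$ of the Hamming graph $K_m^2$ together with an isomorphism $\psi:S(2,m)\to H$ such that $\psi(i,i)=(i,i)$ for all $i\in\{0,\dots,m-1\}$ (equivalently, such that the images of the corner vertices $(i,i)$ of $S(2,m)$ are exactly the constant vertices $(0,0),(1,1),\dots,(m-1,m-1)$).
   Context: The Sierpinski graph $S(2,m)$ has vertex set $\{0,\dots,m-1\}^2$; $(a,i)$ and $(a,j)$ are adjacent for $i\ne j$, and $(i,j)$ and $(j,i)$ are adjacent for $i\neq j$; there are no other edges. Its corner vertices are $(i,i)$, $0\le i<m$ (the vertices of degree $m-1$). The Hamming graph $K_m^2$ has vertex set $\{0,\dots,m-1\}^2$, two vertices adjacent iff they differ in exactly one coordinate. -}

module Defs where

open import Data.Nat using (ℕ)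
open import Data.Fin using (Fin)
open import Data.Product using (_×_; _,_; Σ)
open import Data.Sum using (_⊎_)
open import Relation.Nullary using (¬_)
open import Relation.Binary.PropositionalEquality using (_≡_; _≢_)
open import Level using (0ℓ) renaming (suc to lsuc)

Vtx : ℕ → Set
Vtx m = Fin m × Fin m

SAdj : (m : ℕ) → Vtx m → Vtx m → Set
SAdj m (a , i) (b , j) =
  (a ≡ b × i ≢ j) ⊎ (a ≡ j × i ≡ b × a ≢ i)

HAdj : (m : ℕ) → Vtx m → Vtx m → Set
HAdj m (a , i) (b , j) = (a ≡ b × i ≢ j) ⊎ (a ≢ b × i ≡ j)

record HammingSubgraph (m : ℕ) : Set₁ where
  field
    Vert     : Vtx m → Set
    Edge     : Vtx m → Vtx m → Set
    edgeSym  : ∀ {u v} → Edge u v → Edge v u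
    edgeHam  : ∀ {u v} → Edge u v → HAdj m u v
    edgeVertˡ : ∀ {u v} → Edge u v → Vert u
    edgeVertʳ : ∀ {u v} → Edge u v → Vert v

record IsoSH (m : ℕ) (H : HammingSubgraph m) (ψ : Vtx m → Vtx m) : Set where
  open HammingSubgraph H
  field
    inVert    : ∀ x → Vert (ψ x)
    injective : ∀ x y → ψ x ≡ ψ y → x ≡ y
    onto      : ∀ v → Vert v → Σ (Vtx m) (λ x → ψ x ≡ v)
    adjPres   : ∀ x y → SAdj m x y → Edge (ψ x) (ψ y)
    adjRefl   : ∀ x y → Edge (ψ x) (ψ y) → SAdj m x y

-- Each clique {a} × Fin m of S(2,m) is sent onto a line of K_m^2 through the corner (a,a), and
-- these lines are either all rows or all columns, since a row and a column always meet. In the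
-- row case ψ(a,i) = (a, L a i), where L is an idempotent Latin square that is symmetric because
-- the edge (i,j)(j,i) must become a column edge. Counting the zeros of L: there is one per row,
-- the off-diagonal ones come in pairs (i,j),(j,i), and only L 0 0 is a zero on the diagonal.
-- Hence m = 1 + 2k is odd.
module Submission where

open import Defs
open import Data.Nat using (ℕ; zero; suc; _+_; _>_; s≤s)
import Data.Nat.Properties as ℕ
open import Data.Nat.Divisibility using (_∣_; ∣m+n∣m⇒∣n; ∣1⇒≡1; divides)
open import Data.Nat.Tactic.RingSolver using (solve-∀)
open import Data.Fin using (Fin; zero; suc; punchIn; punchOut; _≟_)
open import Data.Fin.Properties using (any?; punchOut-injective; injective⇒≤; punchInᵢ≢i)
open import Data.Product using (Σ; ∃; ∃-syntax; _×_; _,_; proj₁; proj₂; swap)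
open import Data.Product.Properties using (,-injectiveʳ)
open import Data.Sum as Sum using (_⊎_; inj₁; inj₂)
open import Data.Bool using (if_then_else_)
open import Data.Empty using (⊥; ⊥-elim)
open import Function using (_∘_)
open import Function.Definitions using (Injective)
open import Relation.Nullary using (¬_; yes; no; does; contradiction)
open import Relation.Nullary.Decidable using (dec-true; dec-false)
open import Relation.Binary.PropositionalEquality
open import Algebra.Properties.CommutativeMonoid.Sum ℕ.+-0-commutativeMonoid
  using (sum-syntax; sum-remove; sum-cong-≗; sum-replicate-zero; ∑-distrib-+)

injective⇒surjective : ∀ {n} (f : Fin n → Fin n) → Injective _≡_ _≡_ f →
                       ∀ y → ∃ λ x → f x ≡ y
injective⇒surjective {zero}  f f-inj ()
injective⇒surjective {suc n} f f-inj y with any? (λ x → f x ≟ y)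
... | yes hit = hit
... | no miss = contradiction (injective⇒≤ {f = g} g-inj) ℕ.1+n≰n
  where
  y≢f : ∀ x → y ≢ f x
  y≢f x y≡fx = miss (x , sym y≡fx)
  g : Fin (suc n) → Fin n
  g x = punchOut (y≢f x)
  g-inj : Injective _≡_ _≡_ g
  g-inj = f-inj ∘ punchOut-injective (y≢f _) (y≢f _)

δ : ∀ {n} → Fin n → Fin n → ℕ
δ x y = if does (x ≟ y) then 1 else 0

δ-≡ : ∀ {n} {x y : Fin n} → x ≡ y → δ x y ≡ 1
δ-≡ {x = x} {y} x≡y = cong (if_then 1 else 0) (dec-true (x ≟ y) x≡y)

δ-≢ : ∀ {n} {x y : Fin n} → x ≢ y → δ x y ≡ 0
δ-≢ {x = x} {y} x≢y = cong (if_then 1 else 0) (dec-false (x ≟ y) x≢y)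

∑-const-1 : ∀ n → ∑[ i < n ] 1 ≡ n
∑-const-1 zero    = refl
∑-const-1 (suc n) = cong suc (∑-const-1 n)

∑-δ-injective : ∀ {n m} (f : Fin (suc n) → Fin m) → Injective _≡_ _≡_ f →
                ∀ {x y} → f x ≡ y → ∑[ i < suc n ] δ (f i) y ≡ 1
∑-δ-injective {n} f f-inj {x} {y} fx≡y = begin
  ∑[ i < suc n ] δ (f i) y                      ≡⟨ sum-remove {i = x} (λ i → δ (f i) y) ⟩
  δ (f x) y + ∑[ i < n ] δ (f (punchIn x i)) y  ≡⟨ cong₂ _+_ (δ-≡ fx≡y) (sum-cong-≗ (δ-≢ ∘ missed)) ⟩
  1 + ∑[ i < n ] 0                              ≡⟨ cong suc (sum-replicate-zero n) ⟩
  1                                             ∎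
  where
  open ≡-Reasoning
  missed : ∀ i → f (punchIn x i) ≢ y
  missed i fpx≡y = punchInᵢ≢i x i (f-inj (trans fpx≡y (sym fx≡y)))

∑∑-symmetric : ∀ n (h : Fin n → Fin n → ℕ) → (∀ i j → h i j ≡ h j i) →
               ∃[ k ] ∑[ i < n ] ∑[ j < n ] h i j ≡ ∑[ i < n ] h i i + (k + k)
∑∑-symmetric zero    h h-sym = 0 , refl
∑∑-symmetric (suc n) h h-sym
  with ∑∑-symmetric n (λ i j → h (suc i) (suc j)) (λ i j → h-sym (suc i) (suc j))
... | k , ih = a + k , (begin
  (h zero zero + a) + ∑[ i < n ] (h (suc i) zero + ∑[ j < n ] h (suc i) (suc j))
    ≡⟨ cong (h zero zero + a +_) (∑-distrib-+ (λ i → h (suc i) zero) _) ⟩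
  (h zero zero + a) + (∑[ i < n ] h (suc i) zero + ∑[ i < n ] ∑[ j < n ] h (suc i) (suc j))
    ≡⟨ cong₂ (λ x y → h zero zero + a + (x + y)) (sum-cong-≗ (λ i → h-sym (suc i) zero)) ih ⟩
  (h zero zero + a) + (a + (∑[ i < n ] h (suc i) (suc i) + (k + k)))
    ≡⟨ regroup (h zero zero) a _ k ⟩
  ∑[ i < suc n ] h i i + ((a + k) + (a + k)) ∎)
  where
  open ≡-Reasoning
  a : ℕ
  a = ∑[ j < n ] h zero (suc j)
  regroup : ∀ d a e k → (d + a) + (a + (e + (k + k))) ≡ (d + e) + ((a + k) + (a + k))
  regroup = solve-∀

¬2∣1+k+k : ∀ k → ¬ 2 ∣ suc (k + k)
¬2∣1+k+k k 2∣1+k+k =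
  contradiction (∣1⇒≡1 (∣m+n∣m⇒∣n (subst (2 ∣_) (ℕ.+-comm 1 (k + k)) 2∣1+k+k) 2∣k+k)) λ ()
  where
  2∣k+k : 2 ∣ k + k
  2∣k+k = divides k (trans (cong (k +_) (sym (ℕ.+-identityʳ k))) (ℕ.*-comm 2 k))

idempotentSymmetricLatin⇒odd : ∀ {n} (L : Fin (suc n) → Fin (suc n) → Fin (suc n)) →
  (∀ a → L a a ≡ a) → (∀ a → Injective _≡_ _≡_ (L a)) → (∀ a b → L a b ≡ L b a) →
  ¬ 2 ∣ suc n
idempotentSymmetricLatin⇒odd {n} L idem row-inj L-sym
  with ∑∑-symmetric (suc n) (λ i j → δ (L i j) zero) (λ i j → cong (λ z → δ z zero) (L-sym i j))
... | k , zeros = ¬2∣1+k+k k ∘ subst (2 ∣_) (begin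
  suc n                                          ≡⟨ ∑-const-1 (suc n) ⟨
  ∑[ i < suc n ] 1                               ≡⟨ sum-cong-≗ one-per-row ⟨
  ∑[ i < suc n ] ∑[ j < suc n ] δ (L i j) zero   ≡⟨ zeros ⟩
  ∑[ i < suc n ] δ (L i i) zero + (k + k)        ≡⟨ cong (_+ (k + k)) one-on-diagonal ⟩
  suc (k + k)                                    ∎)
  where
  open ≡-Reasoning
  one-per-row : ∀ i → ∑[ j < suc n ] δ (L i j) zero ≡ 1
  one-per-row i =
    ∑-δ-injective (L i) (row-inj i) (proj₂ (injective⇒surjective (L i) (row-inj i) zero))
  one-on-diagonal : ∑[ i < suc n ] δ (L i i) zero ≡ 1
  one-on-diagonal = trans (sum-cong-≗ (λ i → cong (λ z → δ z zero) (idem i)))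
                          (∑-δ-injective {n} (λ i → i) (λ e → e) {zero} refl)

HAdj-swap : ∀ {m} {u v : Vtx m} → HAdj m u v → HAdj m (swap u) (swap v)
HAdj-swap (inj₁ (a≡b , i≢j)) = inj₂ (i≢j , a≡b)
HAdj-swap (inj₂ (a≢b , i≡j)) = inj₁ (i≡j , a≢b)

triangle-sameRow : ∀ {m} {u v w : Vtx m} → HAdj m u v → HAdj m u w → HAdj m v w →
                   proj₁ u ≡ proj₁ v → proj₁ u ≡ proj₁ w
triangle-sameRow (inj₂ (a≢b , _)) _                  _                  a≡b = contradiction a≡b a≢b
triangle-sameRow _                (inj₁ (a≡c , _))   _                  _   = a≡c
triangle-sameRow _                _                  (inj₁ (b≡c , _))   a≡b = trans a≡b b≡c
triangle-sameRow (inj₁ (_ , x≢y)) (inj₂ (_ , x≡z))   (inj₂ (_ , y≡z))   _   =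
  contradiction (trans x≡z (sym y≡z)) x≢y

IsClique : ∀ {m k} → (Fin k → Vtx m) → Set
IsClique {m} q = ∀ i j → i ≢ j → HAdj m (q i) (q j)

clique-sameRow : ∀ {m k} (q : Fin (suc (suc k)) → Vtx m) → IsClique q →
                 proj₁ (q zero) ≡ proj₁ (q (suc zero)) → ∀ i → proj₁ (q zero) ≡ proj₁ (q i)
clique-sameRow q q-clique sameRow₀₁ zero          = refl
clique-sameRow q q-clique sameRow₀₁ (suc zero)    = sameRow₀₁
clique-sameRow q q-clique sameRow₀₁ (suc (suc i)) =
  triangle-sameRow (q-clique _ _ λ ()) (q-clique _ _ λ ()) (q-clique _ _ λ ()) sameRow₀₁

clique-inLine : ∀ {m k} (q : Fin (suc (suc k)) → Vtx m) → IsClique q →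
                (∀ i → proj₁ (q zero) ≡ proj₁ (q i)) ⊎ (∀ i → proj₂ (q zero) ≡ proj₂ (q i))
clique-inLine q q-clique with q-clique zero (suc zero) (λ ())
... | inj₁ (sameRow₀₁ , _) = inj₁ (clique-sameRow q q-clique sameRow₀₁)
... | inj₂ (_ , sameCol₀₁) =
  inj₂ (clique-sameRow (swap ∘ q) (λ i j i≢j → HAdj-swap (q-clique i j i≢j)) sameCol₀₁)

record CornerFixingEmbedding (m : ℕ) (ψ : Vtx m → Vtx m) : Set where
  field
    injective    : Injective _≡_ _≡_ ψ
    homomorphism : ∀ x y → SAdj m x y → HAdj m (ψ x) (ψ y)
    fixesCorners : ∀ i → ψ (i , i) ≡ (i , i)

transposed : ∀ {m ψ} → CornerFixingEmbedding m ψ → CornerFixingEmbedding m (swap ∘ ψ)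
transposed e = record
  { injective    = injective ∘ cong swap
  ; homomorphism = λ x y → HAdj-swap ∘ homomorphism x y
  ; fixesCorners = cong swap ∘ fixesCorners
  }
  where open CornerFixingEmbedding e

-- Columns are treated as rows of the transposed map: IntoRow (swap ∘ ψ) a says that ψ sends
-- {a} × Fin m into the a-th column.
IntoRow : ∀ {m} → (Vtx m → Vtx m) → Fin m → Set
IntoRow ψ a = ∀ i → proj₁ (ψ (a , i)) ≡ a

module _ {n} {ψ : Vtx (suc (suc n)) → Vtx (suc (suc n))}
         (e : CornerFixingEmbedding (suc (suc n)) ψ) where
  open CornerFixingEmbedding e

  intoRowOrColumn : ∀ a → IntoRow ψ a ⊎ IntoRow (swap ∘ ψ) a
  intoRowOrColumn a =
    Sum.map (pinned (cong proj₁ (fixesCorners a))) (pinned (cong proj₂ (fixesCorners a)))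
      (clique-inLine (λ i → ψ (a , i)) (λ i j i≢j → homomorphism _ _ (inj₁ (refl , i≢j))))
    where
    pinned : ∀ {f : Fin (suc (suc n)) → Fin (suc (suc n))} →
             f a ≡ a → (∀ i → f zero ≡ f i) → ∀ i → f i ≡ a
    pinned fa≡a constant i = trans (sym (constant i)) (trans (constant a) fa≡a)

  intoRow-injective : ∀ {a} → IntoRow ψ a → Injective _≡_ _≡_ (λ i → proj₂ (ψ (a , i)))
  intoRow-injective row {i} {j} eq =
    ,-injectiveʳ (injective (cong₂ _,_ (trans (row i) (sym (row j))) eq))

  intoRow-hits : ∀ {a} → IntoRow ψ a → ∀ b → ∃ λ i → ψ (a , i) ≡ (a , b)
  intoRow-hits row b with injective⇒surjective _ (intoRow-injective row) b
  ... | i , ψai₂≡b = i , cong₂ _,_ (row i) ψai₂≡b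

module _ {n} {ψ : Vtx (suc (suc n)) → Vtx (suc (suc n))}
         (e : CornerFixingEmbedding (suc (suc n)) ψ) where
  open CornerFixingEmbedding e

  -- Row a and column b meet in (a , b), which forces a ≡ b; but then the whole clique
  -- {a} × Fin m would be sent to (a , a).
  ¬intoRow×intoColumn : ∀ {a b} → IntoRow ψ a → IntoRow (swap ∘ ψ) b → ⊥
  ¬intoRow×intoColumn {a} {b} row col
    with intoRow-hits e row b | intoRow-hits (transposed e) col a
  ... | i , ψai≡ab | j , ψbj≡ba with injective (trans ψai≡ab (cong swap (sym ψbj≡ba)))
  ... | refl = 0≢1 (,-injectiveʳ (injective (trans (toCorner zero) (sym (toCorner (suc zero))))))
    where
    toCorner : ∀ k → ψ (a , k) ≡ (a , a)
    toCorner k = cong₂ _,_ (row k) (col k)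
    0≢1 : zero ≢ suc zero
    0≢1 ()

  allIntoRows : IntoRow ψ zero → ∀ a → IntoRow ψ a
  allIntoRows row₀ a with intoRowOrColumn e a
  ... | inj₁ row = row
  ... | inj₂ col = ⊥-elim (¬intoRow×intoColumn row₀ col)

  intoRows⇒odd : IntoRow ψ zero → ¬ 2 ∣ suc (suc n)
  intoRows⇒odd row₀ = idempotentSymmetricLatin⇒odd L (cong proj₂ ∘ fixesCorners)
    (intoRow-injective e ∘ allIntoRows row₀) L-sym
    where
    L : Fin (suc (suc n)) → Fin (suc (suc n)) → Fin (suc (suc n))
    L a i = proj₂ (ψ (a , i))
    -- The edge (i , j) (j , i) joins different rows of K_m^2, so it must be a column edge.
    L-sym : ∀ i j → L i j ≡ L j i
    L-sym i j with i ≟ j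
    ... | yes refl = refl
    ... | no i≢j with homomorphism (i , j) (j , i) (inj₂ (refl , refl , i≢j))
    ...   | inj₁ (same-row , _) = contradiction
      (trans (sym (allIntoRows row₀ i j)) (trans same-row (allIntoRows row₀ j i))) i≢j
    ...   | inj₂ (_ , same-column) = same-column

noCornerFixingEmbedding : ∀ {n ψ} → CornerFixingEmbedding (suc (suc n)) ψ → ¬ 2 ∣ suc (suc n)
noCornerFixingEmbedding e with intoRowOrColumn e zero
... | inj₁ row₀ = intoRows⇒odd e row₀
... | inj₂ col₀ = intoRows⇒odd (transposed e) col₀

mainTheorem13 : (m : ℕ) → m > 2 → 2 ∣ m →
    ¬ (Σ (HammingSubgraph m) λ H → Σ (Vtx m → Vtx m) λ ψ →
    IsoSH m H ψ × ((i : Fin m) → ψ (i , i) ≡ (i , i)))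
mainTheorem13 (suc (suc n)) _ 2∣m (H , ψ , iso , fix) = noCornerFixingEmbedding embedding 2∣m
  where
  embedding : CornerFixingEmbedding (suc (suc n)) ψ
  embedding = record
    { injective    = IsoSH.injective iso _ _
    ; homomorphism = λ x y → HammingSubgraph.edgeHam H ∘ IsoSH.adjPres iso x y
    ; fixesCorners = fix
    }
mainTheorem13 (suc zero) (s≤s ()) _
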